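{- Let $m$ and $n$ be positive integers with $n \geq 4$ even, let $0 \leq \ell \leq n-1$ be an integer of the same parity as $m$, and let $$G = \langle t,x,y \mid t^2,\ x^{n/2},\ y^m = x^{(\ell + m)/2},\ txt = x^{ -1},\ tyt = y^{ -1},\ xy = yx\rangle.$$ Then there exists an automorphism of $G$ of order $3$ that maps the set $\{t,tx,ty\}$ onto itself if and only if $\gcd(n,\ell+m) = \gcd(n,\ell-m) = 2m$ and $2mn \mid (\ell^2 + 3m^2)$. -}

module Defs where

open import Data.Nat using (ℕ; zero; suc; _+_; _*_; _/_)
open import Data.Nat.GCD using (gcd)
open import Data.Product using (Σ; _×_; _,_)
open import Data.Sum using (_⊎_)
open import Relation.Nullary using (¬_)

data Gen : Set where
  t x y : Gen

data Word : Set where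
  gen : Gen → Word
  e   : Word
  _·_ : Word → Word → Word
  inv : Word → Word

infixl 7 _·_

pow : Word → ℕ → Word
pow w zero    = e
pow w (suc k) = w · pow w k

-- The group
--   G = ⟨ t, x, y | t², x^{n/2}, y^m = x^{(ℓ+m)/2}, txt = x⁻¹, tyt = y⁻¹, xy = yx ⟩
-- as the setoid of words modulo the congruence generated by the group
-- axioms and the defining relations (parameters m n ℓ).
module Presentation (m n ℓ : ℕ) where

  T X Y : Word
  T = gen t
  X = gen x
  Y = gen y

  infix 4 _≈_
  data _≈_ : Word → Word → Set where
    ≈-refl  : ∀ {a} → a ≈ a
    ≈-sym   : ∀ {a b} → a ≈ b → b ≈ a
    ≈-trans : ∀ {a b c} → a ≈ b → b ≈ c → a ≈ c
    ·-cong  : ∀ {a a′ b b′} → a ≈ a′ → b ≈ b′ → a · b ≈ a′ · b′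
    inv-cong : ∀ {a a′} → a ≈ a′ → inv a ≈ inv a′
    assoc   : ∀ a b c → (a · b) · c ≈ a · (b · c)
    idˡ     : ∀ a → e · a ≈ a
    idʳ     : ∀ a → a · e ≈ a
    invˡ    : ∀ a → inv a · a ≈ e
    invʳ    : ∀ a → a · inv a ≈ e
    rel-t²  : T · T ≈ e
    rel-x   : pow X (n / 2) ≈ e
    rel-y   : pow Y m ≈ pow X ((ℓ + m) / 2)
    rel-tx  : T · X · T ≈ inv X
    rel-ty  : T · Y · T ≈ inv Y
    rel-xy  : X · Y ≈ Y · X

  record Automorphism : Set where
    field
      φ        : Word → Word
      φ-cong   : ∀ {a b} → a ≈ b → φ a ≈ φ b
      φ-hom    : ∀ a b → φ (a · b) ≈ φ a · φ b
      φ-inj    : ∀ {a b} → φ a ≈ φ b → a ≈ b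
      φ-surj   : ∀ g → Σ Word (λ a → φ a ≈ g)

  InS : Word → Set
  InS w = (w ≈ T) ⊎ (w ≈ T · X) ⊎ (w ≈ T · Y)

  -- φ has order exactly 3 (3 is prime: φ³ = id and φ ≠ id)
  HasOrder3 : Automorphism → Set
  HasOrder3 A = (∀ a → φ (φ (φ a)) ≈ a) × ¬ (∀ a → φ a ≈ a)
    where open Automorphism A

  MapsSOnto : Automorphism → Set
  MapsSOnto A =
    (InS (φ T) × InS (φ (T · X)) × InS (φ (T · Y)))
    × (∀ w → InS w → Σ Word (λ s → InS s × (φ s ≈ w)))
    where open Automorphism A

-- In G every element has the normal form t^s x^i y^j, and x^a y^b = 1 exactly when (a , b)
-- lies in the lattice L ⊆ ℤ² spanned by (n/2 , 0) and ((ℓ+m)/2 , - m); so G is C₂ ⋉ ℤ²/L.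
-- An automorphism of order 3 permuting S = {t , t x , t y} cannot fix S pointwise (S generates G),
-- so it cycles S, and up to replacing it by its square it is t ↦ t x ↦ t y ↦ t, that is
-- x = t (t x) ↦ (t x) (t y) = x⁻¹ y and y ↦ (t x) t = x⁻¹. This assignment is well defined on G
-- iff the linear map (a , b) ↦ (- a - b , a) preserves L, which unwinds to n/2 = m N′,
-- (ℓ+m)/2 = m (K₀ + 1) and N′ ∣ K₀² + K₀ + 1: the gcd and divisibility conditions in disguise.
-- As those conditions are decidable, the forward direction may argue classically about
-- possible coincidences among t, t x and t y.
module Submission where

open import Algebra.Bundles using (Group)
open import Data.Bool using (Bool; true; false; _xor_)
open import Data.Empty using (⊥; ⊥-elim)
open import Data.List using (_∷_; [])
open import Data.Nat using (ℕ; zero; suc)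
open import Data.Sum using (_⊎_; inj₁; inj₂)
open import Function using (_∘_)
open import Level using (0ℓ)
open import Relation.Binary.Bundles using (Setoid)
open import Relation.Binary.PropositionalEquality as ≡ using (_≡_; _≢_)
open import Relation.Nullary using (¬_; Dec; yes; no)

module IntegerPowers {c ℓ} (G : Group c ℓ) where

  open Group G
  open import Algebra.Properties.Group G
  open import Data.Integer using (ℤ; +_; -[1+_]; 1ℤ; -1ℤ; -_; _+_; _*_)
  import Data.Integer.Properties as ℤ
  open import Data.Integer.Tactic.RingSolver using (solve-∀)
  import Data.Nat as ℕ
  import Data.Nat.Properties as ℕ
  open import Relation.Binary.Reasoning.Setoid setoid

  private
    -- Monoid.Mult is written additively: n × x is the n-fold product x ∙ ⋯ ∙ x.
    open import Algebra.Properties.Monoid.Mult monoid using (_×_; ×-congʳ; ×-homo-+)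

    ×-sucʳ : ∀ n x → suc n × x ≈ n × x ∙ x
    ×-sucʳ n x = begin
      suc n × x         ≡⟨ ≡.cong (_× x) (ℕ.+-comm 1 n) ⟩
      (n ℕ.+ 1) × x     ≈⟨ ×-homo-+ x n 1 ⟩
      n × x ∙ (x ∙ ε)   ≈⟨ ∙-congˡ (identityʳ x) ⟩
      n × x ∙ x         ∎

    ⁻¹-× : ∀ n x → (n × x) ⁻¹ ≈ n × (x ⁻¹)
    ⁻¹-× zero    x = ε⁻¹≈ε
    ⁻¹-× (suc n) x = begin
      (x ∙ n × x) ⁻¹       ≈⟨ ⁻¹-anti-homo-∙ x (n × x) ⟩
      (n × x) ⁻¹ ∙ x ⁻¹    ≈⟨ ∙-congʳ (⁻¹-× n x) ⟩
      n × (x ⁻¹) ∙ x ⁻¹    ≈⟨ ×-sucʳ n (x ⁻¹) ⟨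
      suc n × (x ⁻¹)       ∎

    ×-ε : ∀ n → n × ε ≈ ε
    ×-ε zero    = refl
    ×-ε (suc n) = trans (identityˡ _) (×-ε n)

  infixr 8 _^_
  _^_ : Carrier → ℤ → Carrier
  x ^ + n      = n × x
  x ^ -[1+ n ] = suc n × (x ⁻¹)

  ^-congˡ : ∀ {x y} → x ≈ y → ∀ i → x ^ i ≈ y ^ i
  ^-congˡ x≈y (+ n)    = ×-congʳ n x≈y
  ^-congˡ x≈y -[1+ n ] = ×-congʳ (suc n) (⁻¹-cong x≈y)

  ε^ : ∀ i → ε ^ i ≈ ε
  ε^ (+ n)    = ×-ε n
  ε^ -[1+ n ] = trans (×-congʳ (suc n) ε⁻¹≈ε) (×-ε (suc n))

  ^-neg : ∀ x i → x ^ (- i) ≈ (x ^ i) ⁻¹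
  ^-neg x (+ zero)  = sym ε⁻¹≈ε
  ^-neg x (+ suc n) = sym (⁻¹-× (suc n) x)
  ^-neg x -[1+ n ]  = begin
    suc n × x             ≈⟨ ×-congʳ (suc n) (⁻¹-involutive x) ⟨
    suc n × (x ⁻¹ ⁻¹)     ≈⟨ ⁻¹-× (suc n) (x ⁻¹) ⟨
    (suc n × (x ⁻¹)) ⁻¹   ∎

  ⁻¹-^ : ∀ x i → (x ⁻¹) ^ i ≈ (x ^ i) ⁻¹
  ⁻¹-^ x (+ n)    = sym (⁻¹-× n x)
  ⁻¹-^ x -[1+ n ] = trans (×-congʳ (suc n) (⁻¹-involutive x)) (^-neg x -[1+ n ])

  private
    ^-suc : ∀ x i → x ^ (1ℤ + i) ≈ x ∙ x ^ i
    ^-suc x (+ n)          = refl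
    ^-suc x -[1+ zero ]    = sym (trans (∙-congˡ (identityʳ (x ⁻¹))) (inverseʳ x))
    ^-suc x -[1+ suc n ]   = sym (trans (sym (assoc _ _ _)) (trans (∙-congʳ (inverseʳ x)) (identityˡ _)))

    ^-pred : ∀ x i → x ^ (-1ℤ + i) ≈ x ⁻¹ ∙ x ^ i
    ^-pred x -[1+ n ]      = refl
    ^-pred x (+ zero)      = refl
    ^-pred x (+ suc n)     = sym (trans (sym (assoc _ _ _)) (trans (∙-congʳ (inverseˡ x)) (identityˡ _)))

  ^-homo-+ : ∀ x i j → x ^ (i + j) ≈ x ^ i ∙ x ^ j
  ^-homo-+ x (+ zero) j = begin
    x ^ (+ 0 + j)     ≡⟨ ≡.cong (x ^_) (ℤ.+-identityˡ j) ⟩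
    x ^ j             ≈⟨ identityˡ _ ⟨
    ε ∙ x ^ j         ∎
  ^-homo-+ x (+ suc n) j = begin
    x ^ (+ suc n + j)         ≡⟨ ≡.cong (x ^_) (ℤ.+-assoc 1ℤ (+ n) j) ⟩
    x ^ (1ℤ + (+ n + j))      ≈⟨ ^-suc x (+ n + j) ⟩
    x ∙ x ^ (+ n + j)         ≈⟨ ∙-congˡ (^-homo-+ x (+ n) j) ⟩
    x ∙ (n × x ∙ x ^ j)       ≈⟨ assoc _ _ _ ⟨
    suc n × x ∙ x ^ j         ∎
  ^-homo-+ x -[1+ zero ] j = trans (^-pred x j) (∙-congʳ (sym (identityʳ _)))
  ^-homo-+ x -[1+ suc n ] j = begin
    x ^ (-[1+ suc n ] + j)          ≡⟨ ≡.cong (x ^_) (ℤ.+-assoc -1ℤ -[1+ n ] j) ⟩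
    x ^ (-1ℤ + (-[1+ n ] + j))      ≈⟨ ^-pred x (-[1+ n ] + j) ⟩
    x ⁻¹ ∙ x ^ (-[1+ n ] + j)       ≈⟨ ∙-congˡ (^-homo-+ x -[1+ n ] j) ⟩
    x ⁻¹ ∙ (x ^ -[1+ n ] ∙ x ^ j)   ≈⟨ assoc _ _ _ ⟨
    x ^ -[1+ suc n ] ∙ x ^ j        ∎

  private
    ^-*-+ : ∀ x i n → x ^ (i * + n) ≈ (x ^ i) ^ + n
    ^-*-+ x i zero    = reflexive (≡.cong (x ^_) (ℤ.*-zeroʳ i))
    ^-*-+ x i (suc n) = begin
      x ^ (i * + suc n)        ≡⟨ ≡.cong (x ^_) (distrib i (+ n)) ⟩
      x ^ (i + i * + n)        ≈⟨ ^-homo-+ x i (i * + n) ⟩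
      x ^ i ∙ x ^ (i * + n)    ≈⟨ ∙-congˡ (^-*-+ x i n) ⟩
      x ^ i ∙ n × (x ^ i)      ∎
      where distrib : ∀ i k → i * (1ℤ + k) ≡ i + i * k
            distrib = solve-∀

  ^-* : ∀ x i j → x ^ (i * j) ≈ (x ^ i) ^ j
  ^-* x i (+ n)    = ^-*-+ x i n
  ^-* x i -[1+ n ] = begin
    x ^ (i * -[1+ n ])         ≡⟨ ≡.cong (x ^_) (ℤ.neg-distribʳ-* i (+ suc n)) ⟨
    x ^ (- (i * + suc n))      ≈⟨ ^-neg x (i * + suc n) ⟩
    (x ^ (i * + suc n)) ⁻¹     ≈⟨ ⁻¹-cong (^-*-+ x i (suc n)) ⟩
    (suc n × (x ^ i)) ⁻¹       ≈⟨ ⁻¹-× (suc n) (x ^ i) ⟩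
    suc n × ((x ^ i) ⁻¹)       ∎

  module Endomorphism (h : Carrier → Carrier) (h-cong : ∀ {x y} → x ≈ y → h x ≈ h y)
                      (h-hom : ∀ x y → h (x ∙ y) ≈ h x ∙ h y) where

    h-ε : h ε ≈ ε
    h-ε = identityˡ-unique (h ε) (h ε) (trans (sym (h-hom ε ε)) (h-cong (identityˡ ε)))

    h-⁻¹ : ∀ x → h (x ⁻¹) ≈ h x ⁻¹
    h-⁻¹ x = inverseˡ-unique (h (x ⁻¹)) (h x) (trans (sym (h-hom (x ⁻¹) x)) (trans (h-cong (inverseˡ x)) h-ε))

    private
      h-× : ∀ n x → h (n × x) ≈ n × h x
      h-× zero    x = h-ε
      h-× (suc n) x = trans (h-hom x (n × x)) (∙-congˡ (h-× n x))

    h-^ : ∀ x i → h (x ^ i) ≈ h x ^ i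
    h-^ x (+ n)    = h-× n x
    h-^ x -[1+ n ] = trans (h-× (suc n) (x ⁻¹)) (×-congʳ (suc n) (h-⁻¹ x))

  conj : Carrier → Carrier → Carrier
  conj g x = g ∙ x ∙ g ⁻¹

  conj-cong : ∀ g {x y} → x ≈ y → conj g x ≈ conj g y
  conj-cong g x≈y = ∙-congʳ (∙-congˡ x≈y)

  conj-hom : ∀ g x y → conj g (x ∙ y) ≈ conj g x ∙ conj g y
  conj-hom g x y = begin
    g ∙ (x ∙ y) ∙ g ⁻¹                ≈⟨ ∙-congʳ (∙-congˡ (∙-congʳ (//-rightDividesˡ g x))) ⟨
    g ∙ (x ∙ g ⁻¹ ∙ g ∙ y) ∙ g ⁻¹     ≈⟨ ∙-congʳ (∙-congˡ (assoc _ _ _)) ⟩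
    g ∙ (x ∙ g ⁻¹ ∙ (g ∙ y)) ∙ g ⁻¹   ≈⟨ ∙-congʳ (assoc _ _ _) ⟨
    g ∙ (x ∙ g ⁻¹) ∙ (g ∙ y) ∙ g ⁻¹   ≈⟨ ∙-congʳ (∙-congʳ (assoc _ _ _)) ⟨
    g ∙ x ∙ g ⁻¹ ∙ (g ∙ y) ∙ g ⁻¹     ≈⟨ assoc _ _ _ ⟩
    g ∙ x ∙ g ⁻¹ ∙ (g ∙ y ∙ g ⁻¹)     ∎

  module Conj (g : Carrier) = Endomorphism (conj g) (conj-cong g) (conj-hom g)

  conj≈⇒∙-swap : ∀ {g x y} → conj g x ≈ y → g ∙ x ≈ y ∙ g
  conj≈⇒∙-swap {g} {x} {y} gxg⁻¹≈y = begin
    g ∙ x               ≈⟨ //-rightDividesˡ g (g ∙ x) ⟨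
    g ∙ x ∙ g ⁻¹ ∙ g    ≈⟨ ∙-congʳ gxg⁻¹≈y ⟩
    y ∙ g               ∎

  ∙-swap⇒conj≈ : ∀ {g x y} → g ∙ x ≈ y ∙ g → conj g x ≈ y
  ∙-swap⇒conj≈ {g} {x} {y} gx≈yg = trans (∙-congʳ gx≈yg) (//-rightDividesʳ g y)

  commute-^ʳ : ∀ {x y} → x ∙ y ≈ y ∙ x → ∀ j → x ∙ y ^ j ≈ y ^ j ∙ x
  commute-^ʳ {x} {y} xy≈yx j =
    conj≈⇒∙-swap (trans (Conj.h-^ x y j) (^-congˡ (∙-swap⇒conj≈ xy≈yx) j))

  commute-^ : ∀ {x y} → x ∙ y ≈ y ∙ x → ∀ i j → x ^ i ∙ y ^ j ≈ y ^ j ∙ x ^ i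
  commute-^ xy≈yx i j = sym (commute-^ʳ (sym (commute-^ʳ xy≈yx j)) i)

module _ {c ℓ} (S : Setoid c ℓ) where

  open Setoid S
  open import Data.Product using (_×_; _,_; proj₁; proj₂)

  module OrderThreeMaps (φ : Carrier → Carrier) (φ-cong : ∀ {x y} → x ≈ y → φ x ≈ φ y)
    (φ-inj : ∀ {x y} → φ x ≈ φ y → x ≈ y) (φ³≈id : ∀ x → φ (φ (φ x)) ≈ x) where

    infix 4 _∈⟨_,_,_⟩
    _∈⟨_,_,_⟩ : Carrier → Carrier → Carrier → Carrier → Set ℓ
    x ∈⟨ a , b , c ⟩ = x ≈ a ⊎ x ≈ b ⊎ x ≈ c

    rotate-∈ : ∀ {x a b c} → x ∈⟨ a , b , c ⟩ → x ∈⟨ b , c , a ⟩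
    rotate-∈ (inj₁ x≈a)        = inj₂ (inj₂ x≈a)
    rotate-∈ (inj₂ (inj₁ x≈b)) = inj₁ x≈b
    rotate-∈ (inj₂ (inj₂ x≈c)) = inj₂ (inj₁ x≈c)

    swap-∈ : ∀ {x a b c} → x ∈⟨ a , b , c ⟩ → x ∈⟨ a , c , b ⟩
    swap-∈ (inj₁ x≈a)        = inj₁ x≈a
    swap-∈ (inj₂ (inj₁ x≈b)) = inj₂ (inj₂ x≈b)
    swap-∈ (inj₂ (inj₂ x≈c)) = inj₂ (inj₁ x≈c)

    collapse-∈ : ∀ {x a b c} → c ≈ a ⊎ c ≈ b → x ∈⟨ a , b , c ⟩ → x ≈ a ⊎ x ≈ b
    collapse-∈ _          (inj₁ x≈a)        = inj₁ x≈a
    collapse-∈ _          (inj₂ (inj₁ x≈b)) = inj₂ x≈b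
    collapse-∈ (inj₁ c≈a) (inj₂ (inj₂ x≈c)) = inj₁ (trans x≈c c≈a)
    collapse-∈ (inj₂ c≈b) (inj₂ (inj₂ x≈c)) = inj₂ (trans x≈c c≈b)

    φ-collide : ∀ {x y z} → φ x ≈ z → φ y ≈ z → x ≈ y
    φ-collide φx≈z φy≈z = φ-inj (trans φx≈z (sym φy≈z))

    cycle-forced : ∀ {a b c} → ¬ a ≈ b → φ a ≈ b → φ b ∈⟨ a , b , c ⟩ → φ b ≈ c × φ c ≈ a
    cycle-forced a≉b φa≈b (inj₁ φb≈a) =
      ⊥-elim (a≉b (trans (sym (φ³≈id _)) (trans (φ-cong (φ-cong φa≈b)) (trans (φ-cong φb≈a) φa≈b))))
    cycle-forced a≉b φa≈b (inj₂ (inj₁ φb≈b)) = ⊥-elim (a≉b (φ-collide φa≈b φb≈b))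
    cycle-forced {a} _ φa≈b (inj₂ (inj₂ φb≈c)) =
      φb≈c , trans (φ-cong (sym φb≈c)) (trans (φ-cong (φ-cong (sym φa≈b))) (φ³≈id a))

    fixes-pair : ∀ {a b} → ¬ a ≈ b → φ a ≈ a ⊎ φ a ≈ b → φ b ≈ a ⊎ φ b ≈ b → φ a ≈ a × φ b ≈ b
    fixes-pair a≉b (inj₁ φa≈a) (inj₁ φb≈a) = ⊥-elim (a≉b (φ-collide φa≈a φb≈a))
    fixes-pair a≉b (inj₁ φa≈a) (inj₂ φb≈b) = φa≈a , φb≈b
    fixes-pair a≉b (inj₂ φa≈b) φb∈ =
      ⊥-elim (a≉b (φ-collide φa≈b (proj₁ (cycle-forced a≉b φa≈b (widen φb∈)))))
      where
      widen : ∀ {x a b} → x ≈ a ⊎ x ≈ b → x ∈⟨ a , b , b ⟩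
      widen (inj₁ x≈a) = inj₁ x≈a
      widen (inj₂ x≈b) = inj₂ (inj₁ x≈b)

    fixes-degenerate-triple : ∀ {a b c} → ¬ a ≈ b → c ≈ a ⊎ c ≈ b →
      φ a ∈⟨ a , b , c ⟩ → φ b ∈⟨ a , b , c ⟩ → φ a ≈ a × φ b ≈ b × φ c ≈ c
    fixes-degenerate-triple a≉b c≈a∨b φa∈ φb∈
      with φa≈a , φb≈b ← fixes-pair a≉b (collapse-∈ c≈a∨b φa∈) (collapse-∈ c≈a∨b φb∈)
         | c≈a∨b
    ... | inj₁ c≈a = φa≈a , φb≈b , trans (φ-cong c≈a) (trans φa≈a (sym c≈a))
    ... | inj₂ c≈b = φa≈a , φb≈b , trans (φ-cong c≈b) (trans φb≈b (sym c≈b))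

    order-three-on-triple : ∀ {a b c} → ¬ a ≈ b → ¬ b ≈ c → ¬ a ≈ c →
      φ a ∈⟨ a , b , c ⟩ → φ b ∈⟨ a , b , c ⟩ → φ c ∈⟨ a , b , c ⟩ →
      (φ a ≈ a × φ b ≈ b × φ c ≈ c) ⊎ (φ a ≈ b × φ b ≈ c × φ c ≈ a) ⊎ (φ a ≈ c × φ c ≈ b × φ b ≈ a)
    order-three-on-triple a≉b _ _ (inj₂ (inj₁ φa≈b)) φb∈ _ =
      inj₂ (inj₁ (φa≈b , cycle-forced a≉b φa≈b φb∈))
    order-three-on-triple _ _ a≉c (inj₂ (inj₂ φa≈c)) _ φc∈ =
      inj₂ (inj₂ (φa≈c , cycle-forced a≉c φa≈c (swap-∈ φc∈)))
    order-three-on-triple a≉b _ _ (inj₁ φa≈a) (inj₁ φb≈a) _ = ⊥-elim (a≉b (φ-collide φa≈a φb≈a))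
    order-three-on-triple a≉b b≉c _ (inj₁ φa≈a) (inj₂ (inj₂ φb≈c)) φc∈ =
      ⊥-elim (a≉b (trans (sym φa≈a) (proj₂ (cycle-forced b≉c φb≈c (rotate-∈ φc∈)))))
    order-three-on-triple _ _ a≉c (inj₁ φa≈a) (inj₂ (inj₁ _)) (inj₁ φc≈a) =
      ⊥-elim (a≉c (φ-collide φa≈a φc≈a))
    order-three-on-triple _ b≉c _ (inj₁ _) (inj₂ (inj₁ φb≈b)) (inj₂ (inj₁ φc≈b)) =
      ⊥-elim (b≉c (φ-collide φb≈b φc≈b))
    order-three-on-triple _ _ _ (inj₁ φa≈a) (inj₂ (inj₁ φb≈b)) (inj₂ (inj₂ φc≈c)) =
      inj₁ (φa≈a , φb≈b , φc≈c)

module NormalForms where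

  open import Data.Bool.Properties using (xor-assoc)
  open import Data.Integer using (ℤ; 0ℤ; 1ℤ; -1ℤ; -_; _+_; _*_; _-_; ∣_∣; NonZero; ≢-nonZero)
  import Data.Integer.Properties as ℤ
  open import Data.Integer.Tactic.RingSolver using (solve-∀; solve)
  import Data.Nat as ℕ
  import Data.Nat.Properties as ℕ
  open import Data.Product using (∃₂; _×_; _,_)
  open ≡ using (refl; cong; subst₂)
  open ≡.≡-Reasoning

  -- ⟨ s , i , j ⟩ stands for t^s x^i y^j.
  record NF : Set where
    constructor ⟨_,_,_⟩
    field
      flip      : Bool
      xpow ypow : ℤ
  open NF public

  ⟨⟩-cong : ∀ {s s′ i i′ j j′} → s ≡ s′ → i ≡ i′ → j ≡ j′ → ⟨ s , i , j ⟩ ≡ ⟨ s′ , i′ , j′ ⟩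
  ⟨⟩-cong refl refl refl = refl

  sgn : Bool → ℤ → ℤ
  sgn false i = i
  sgn true  i = - i

  sgn-+ : ∀ s i j → sgn s (i + j) ≡ sgn s i + sgn s j
  sgn-+ false i j = refl
  sgn-+ true  i j = ℤ.neg-distrib-+ i j

  sgn-sgn : ∀ s s′ i → sgn s′ (sgn s i) ≡ sgn (s xor s′) i
  sgn-sgn false s′    i = refl
  sgn-sgn true  false i = refl
  sgn-sgn true  true  i = ℤ.neg-involutive i

  sgn-0 : ∀ s → sgn s 0ℤ ≡ 0ℤ
  sgn-0 false = refl
  sgn-0 true  = refl

  infixl 7 _⊛_
  _⊛_ : NF → NF → NF
  ⟨ s , i , j ⟩ ⊛ ⟨ s′ , i′ , j′ ⟩ = ⟨ s xor s′ , sgn s′ i + i′ , sgn s′ j + j′ ⟩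

  1ᴺ : NF
  1ᴺ = ⟨ false , 0ℤ , 0ℤ ⟩

  _⁻¹ᴺ : NF → NF
  ⟨ false , i , j ⟩ ⁻¹ᴺ = ⟨ false , - i , - j ⟩
  ⟨ true  , i , j ⟩ ⁻¹ᴺ = ⟨ true , i , j ⟩

  ⊛-assoc : ∀ u v w → u ⊛ v ⊛ w ≡ u ⊛ (v ⊛ w)
  ⊛-assoc ⟨ s , i , j ⟩ ⟨ s′ , i′ , j′ ⟩ ⟨ s″ , i″ , j″ ⟩ =
    ⟨⟩-cong (xor-assoc s s′ s″) (coordinate i i′ i″) (coordinate j j′ j″)
    where
    coordinate : ∀ a a′ a″ → sgn s″ (sgn s′ a + a′) + a″ ≡ sgn (s′ xor s″) a + (sgn s″ a′ + a″)
    coordinate a a′ a″ = begin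
      sgn s″ (sgn s′ a + a′) + a″            ≡⟨ cong (_+ a″) (sgn-+ s″ (sgn s′ a) a′) ⟩
      sgn s″ (sgn s′ a) + sgn s″ a′ + a″     ≡⟨ cong (λ z → z + sgn s″ a′ + a″) (sgn-sgn s′ s″ a) ⟩
      sgn (s′ xor s″) a + sgn s″ a′ + a″     ≡⟨ ℤ.+-assoc (sgn (s′ xor s″) a) (sgn s″ a′) a″ ⟩
      sgn (s′ xor s″) a + (sgn s″ a′ + a″)   ∎

  ⊛-identityˡ : ∀ u → 1ᴺ ⊛ u ≡ u
  ⊛-identityˡ ⟨ s , i , j ⟩ = ⟨⟩-cong refl
    (≡.trans (cong (_+ i) (sgn-0 s)) (ℤ.+-identityˡ i)) (≡.trans (cong (_+ j) (sgn-0 s)) (ℤ.+-identityˡ j))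

  ⊛-identityʳ : ∀ u → u ⊛ 1ᴺ ≡ u
  ⊛-identityʳ ⟨ s , i , j ⟩ = ⟨⟩-cong (xor-false s) (ℤ.+-identityʳ i) (ℤ.+-identityʳ j)
    where
    xor-false : ∀ s → s xor false ≡ s
    xor-false false = refl
    xor-false true  = refl

  ⊛-inverseˡ : ∀ u → u ⁻¹ᴺ ⊛ u ≡ 1ᴺ
  ⊛-inverseˡ ⟨ false , i , j ⟩ = ⟨⟩-cong refl (ℤ.+-inverseˡ i) (ℤ.+-inverseˡ j)
  ⊛-inverseˡ ⟨ true  , i , j ⟩ = ⟨⟩-cong refl (ℤ.+-inverseˡ i) (ℤ.+-inverseˡ j)

  ⊛-inverseʳ : ∀ u → u ⊛ u ⁻¹ᴺ ≡ 1ᴺ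
  ⊛-inverseʳ ⟨ false , i , j ⟩ = ⟨⟩-cong refl (ℤ.+-inverseʳ i) (ℤ.+-inverseʳ j)
  ⊛-inverseʳ ⟨ true  , i , j ⟩ = ⟨⟩-cong refl (ℤ.+-inverseˡ i) (ℤ.+-inverseˡ j)

  module Lattice (N K M : ℤ) where

    -- In G, x^a y^b = 1 iff ℒ a b, for N = n/2, K = (ℓ+m)/2 and M = m.
    ℒ : ℤ → ℤ → Set
    ℒ a b = ∃₂ λ p q → a ≡ p * N + q * K × b ≡ - (q * M)

    ℒ-resp : ∀ {a a′ b b′} → ℒ a b → a ≡ a′ → b ≡ b′ → ℒ a′ b′
    ℒ-resp l a≡a′ b≡b′ = subst₂ ℒ a≡a′ b≡b′ l

    ℒ-0 : ℒ 0ℤ 0ℤ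
    ℒ-0 = 0ℤ , 0ℤ , refl , refl

    ℒ-N : ℒ N 0ℤ
    ℒ-N = 1ℤ , 0ℤ , solve (N ∷ K ∷ []) , refl

    ℒ-K : ℒ K (- M)
    ℒ-K = 0ℤ , 1ℤ , solve (N ∷ K ∷ []) , solve (M ∷ [])

    ℒ-+ : ∀ {a b c d} → ℒ a b → ℒ c d → ℒ (a + c) (b + d)
    ℒ-+ (p , q , refl , refl) (p′ , q′ , refl , refl) =
      p + p′ , q + q′ , solve (p ∷ q ∷ p′ ∷ q′ ∷ N ∷ K ∷ []) , solve (q ∷ q′ ∷ M ∷ [])

    ℒ-* : ∀ r {a b} → ℒ a b → ℒ (r * a) (r * b)
    ℒ-* r (p , q , refl , refl) = r * p , r * q , solve (r ∷ p ∷ q ∷ N ∷ K ∷ []) , solve (r ∷ q ∷ M ∷ [])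

    ℒ-neg : ∀ {a b} → ℒ a b → ℒ (- a) (- b)
    ℒ-neg {a} {b} l = ℒ-resp (ℒ-* -1ℤ l) (ℤ.-1*i≡-i a) (ℤ.-1*i≡-i b)

    ℒ-sgn : ∀ s {a b} → ℒ a b → ℒ (sgn s a) (sgn s b)
    ℒ-sgn false l = l
    ℒ-sgn true  l = ℒ-neg l

    ℒ-rotate : ℒ (- N) N → ℒ (M - K) K → ∀ {a b} → ℒ a b → ℒ (- a - b) a
    ℒ-rotate ℒ-image-N ℒ-image-K (p , q , refl , refl) =
      ℒ-resp (ℒ-+ (ℒ-* p ℒ-image-N) (ℒ-* q ℒ-image-K)) (rotated p q N K M) refl
      where rotated : ∀ p q N K M → p * - N + q * (M - K) ≡ - (p * N + q * K) - - (q * M)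
            rotated = solve-∀

    infix 4 _~_
    record _~_ (u v : NF) : Set where
      constructor mk~
      field
        flip≡  : flip u ≡ flip v
        ℒ-diff : ℒ (xpow u - xpow v) (ypow u - ypow v)

    ~-reflexive : ∀ {u v} → u ≡ v → u ~ v
    ~-reflexive {⟨ _ , i , j ⟩} refl = mk~ refl (ℒ-resp ℒ-0 (≡.sym (ℤ.+-inverseʳ i)) (≡.sym (ℤ.+-inverseʳ j)))

    ~-refl : ∀ {u} → u ~ u
    ~-refl = ~-reflexive refl

    ~-sym : ∀ {u v} → u ~ v → v ~ u
    ~-sym {⟨ _ , i , j ⟩} {⟨ _ , i′ , j′ ⟩} (mk~ refl l) = mk~ refl (ℒ-resp (ℒ-neg l) (swap i i′) (swap j j′))
      where swap : ∀ a b → - (a - b) ≡ b - a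
            swap = solve-∀

    ~-trans : ∀ {u v w} → u ~ v → v ~ w → u ~ w
    ~-trans {⟨ _ , i , j ⟩} {⟨ _ , i′ , j′ ⟩} {⟨ _ , i″ , j″ ⟩} (mk~ refl l) (mk~ refl l′) =
      mk~ refl (ℒ-resp (ℒ-+ l l′) (telescope i i′ i″) (telescope j j′ j″))
      where telescope : ∀ a b c → (a - b) + (b - c) ≡ a - c
            telescope = solve-∀

    ⊛-cong : ∀ {u u′ v v′} → u ~ u′ → v ~ v′ → u ⊛ v ~ u′ ⊛ v′
    ⊛-cong {⟨ _ , i , j ⟩} {⟨ _ , i₂ , j₂ ⟩} {⟨ s , i′ , j′ ⟩} {⟨ _ , i′₂ , j′₂ ⟩} (mk~ refl l) (mk~ refl l′) =
      mk~ refl (ℒ-resp (ℒ-+ (ℒ-sgn s l) l′) (sgn-difference s i i₂ i′ i′₂) (sgn-difference s j j₂ j′ j′₂))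
      where
      sgn-difference : ∀ s a b c d → sgn s (a - b) + (c - d) ≡ (sgn s a + c) - (sgn s b + d)
      sgn-difference false = difference
        where difference : ∀ a b c d → (a - b) + (c - d) ≡ (a + c) - (b + d)
              difference = solve-∀
      sgn-difference true  = difference
        where difference : ∀ a b c d → - (a - b) + (c - d) ≡ (- a + c) - (- b + d)
              difference = solve-∀

    ⁻¹ᴺ-cong : ∀ {u v} → u ~ v → u ⁻¹ᴺ ~ v ⁻¹ᴺ
    ⁻¹ᴺ-cong {⟨ false , i , j ⟩} {⟨ _ , i′ , j′ ⟩} (mk~ refl l) =
      mk~ refl (ℒ-resp (ℒ-neg l) (negate i i′) (negate j j′))
      where negate : ∀ a b → - (a - b) ≡ - a - - b
            negate = solve-∀
    ⁻¹ᴺ-cong {⟨ true , _ , _ ⟩} {⟨ _ , _ , _ ⟩} (mk~ refl l) = mk~ refl l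

  ℒ[1,0]⇒∣N∣≡1 : ∀ {N K M} → M ≢ 0ℤ → Lattice.ℒ N K M 1ℤ 0ℤ → ∣ N ∣ ≡ 1
  ℒ[1,0]⇒∣N∣≡1 {N} {K} {M} M≢0 (p , q , 1≡pN+qK , 0≡-qM) = ℕ.m*n≡1⇒n≡1 ∣ p ∣ ∣ N ∣ (begin
    ∣ p ∣ ℕ.* ∣ N ∣        ≡⟨ ℤ.abs-* p N ⟨
    ∣ p * N ∣              ≡⟨ cong ∣_∣ (ℤ.+-identityʳ (p * N)) ⟨
    ∣ p * N + 0ℤ * K ∣     ≡⟨ cong (λ z → ∣ p * N + z * K ∣) q≡0 ⟨
    ∣ p * N + q * K ∣      ≡⟨ cong ∣_∣ 1≡pN+qK ⟨
    1                      ∎)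
    where
    q≡0 : q ≡ 0ℤ
    q≡0 with ℤ.i*j≡0⇒i≡0∨j≡0 q (≡.trans (≡.sym (ℤ.neg-involutive (q * M))) (cong -_ (≡.sym 0≡-qM)))
    ... | inj₁ q≡0 = q≡0
    ... | inj₂ M≡0 = ⊥-elim (M≢0 M≡0)

  record RotationShape (N K M : ℤ) : Set where
    field
      a k r : ℤ
      N≡    : N ≡ M * a
      K≡    : K ≡ M * (1ℤ + k)
      a∣    : k * k + k + 1ℤ ≡ r * a

  shape⇒ℒ-rotated-generators : ∀ {N K M} → RotationShape N K M →
                               let open Lattice N K M in ℒ (- N) N × ℒ (M - K) K
  shape⇒ℒ-rotated-generators {M = M} record { a = a ; k = k ; r = r ; N≡ = refl ; K≡ = refl ; a∣ = a∣ } =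
    (k , - a , solve (M ∷ a ∷ k ∷ []) , solve (M ∷ a ∷ [])) , (r , - (1ℤ + k) , image-K , solve (M ∷ k ∷ []))
    where
    image-K : M - M * (1ℤ + k) ≡ r * (M * a) + - (1ℤ + k) * (M * (1ℤ + k))
    image-K = begin
      M - M * (1ℤ + k)                                     ≡⟨ solve (M ∷ k ∷ []) ⟩
      M * (k * k + k + 1ℤ) - (1ℤ + k) * (M * (1ℤ + k))     ≡⟨ cong (λ z → M * z - (1ℤ + k) * (M * (1ℤ + k))) a∣ ⟩
      M * (r * a) - (1ℤ + k) * (M * (1ℤ + k))              ≡⟨ solve (M ∷ r ∷ a ∷ k ∷ []) ⟩
      r * (M * a) + - (1ℤ + k) * (M * (1ℤ + k))            ∎

  ℒ-rotated-generators⇒shape : ∀ {N K M} → N ≢ 0ℤ → M ≢ 0ℤ →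
    let open Lattice N K M in ℒ (- N) N → ℒ (M - K) K → RotationShape N K M
  ℒ-rotated-generators⇒shape {M = M} N≢0 M≢0 (p , q , e₁ , refl) (p₂ , q₂ , e₃ , refl) =
    record { a = - q ; k = p ; r = p₂ ; N≡ = solve (q ∷ M ∷ []) ; K≡ = K≡ ; a∣ = a∣ }
    where
    instance
      M≢0′ : NonZero M
      M≢0′ = ≢-nonZero M≢0
      qM≢0 : NonZero (q * M)
      qM≢0 = ≢-nonZero (λ qM≡0 → N≢0 (cong -_ qM≡0))

    q₂≡ : q₂ ≡ - (1ℤ + p)
    q₂≡ = ℤ.*-cancelʳ-≡ q₂ (- (1ℤ + p)) (q * M) (begin
      q₂ * (q * M)                                          ≡⟨ solve (p ∷ q ∷ q₂ ∷ M ∷ []) ⟩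
      p * - (q * M) - (p * - (q * M) + q * - (q₂ * M))      ≡⟨ cong (λ z → p * - (q * M) - z) e₁ ⟨
      p * - (q * M) - - - (q * M)                           ≡⟨ solve (p ∷ q ∷ M ∷ []) ⟩
      - (1ℤ + p) * (q * M)                                  ∎)

    K≡ : - (q₂ * M) ≡ M * (1ℤ + p)
    K≡ = begin
      - (q₂ * M)             ≡⟨ cong (λ z → - (z * M)) q₂≡ ⟩
      - (- (1ℤ + p) * M)     ≡⟨ solve (p ∷ M ∷ []) ⟩
      M * (1ℤ + p)           ∎

    e₃′ : M - - (- (1ℤ + p) * M) ≡ p₂ * - (q * M) + - (1ℤ + p) * - (- (1ℤ + p) * M)
    e₃′ = ≡.subst (λ z → M - - (z * M) ≡ p₂ * - (q * M) + z * - (z * M)) q₂≡ e₃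

    a∣ : p * p + p + 1ℤ ≡ p₂ * - q
    a∣ = ℤ.*-cancelˡ-≡ M (p * p + p + 1ℤ) (p₂ * - q) (begin
      M * (p * p + p + 1ℤ)
        ≡⟨ solve (p ∷ M ∷ []) ⟩
      M - - (- (1ℤ + p) * M) - - (1ℤ + p) * - (- (1ℤ + p) * M)
        ≡⟨ cong (λ z → z - - (1ℤ + p) * - (- (1ℤ + p) * M)) e₃′ ⟩
      p₂ * - (q * M) + - (1ℤ + p) * - (- (1ℤ + p) * M) - - (1ℤ + p) * - (- (1ℤ + p) * M)
        ≡⟨ solve (p ∷ q ∷ p₂ ∷ M ∷ []) ⟩
      M * (p₂ * - q)
        ∎)

open NormalForms

module NatArithmetic where

  open import Data.Integer as ℤ using (+_; 1ℤ; -1ℤ; ∣_∣)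
  import Data.Integer.Properties as ℤ
  open import Data.Integer.Tactic.RingSolver using (solve)
  open import Data.Nat
  open import Data.Nat.Divisibility
  open import Data.Nat.GCD using (gcd; gcd[m,n]∣m; gcd[m,n]∣n; gcd-greatest)
  open import Data.Nat.Properties
  open import Data.Nat.Tactic.RingSolver using (solve-∀)
  open import Data.Product using (_×_; _,_)
  open import Relation.Binary.PropositionalEquality
  open import Relation.Nullary.Decidable using (_×-dec_)
  open import Relation.Nullary.Negation using (contradiction)
  open ≡-Reasoning

  Criterion : ℕ → ℕ → ℕ → Set
  Criterion m n ℓ = (gcd n (ℓ + m) ≡ 2 * m) × (gcd n ∣ ℓ - m ∣ ≡ 2 * m) × (2 * m * n ∣ ℓ ^ 2 + 3 * m ^ 2)

  criterion? : ∀ m n ℓ → Dec (Criterion m n ℓ)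
  criterion? m n ℓ =
    (gcd n (ℓ + m) ≟ 2 * m) ×-dec (gcd n ∣ ℓ - m ∣ ≟ 2 * m) ×-dec (2 * m * n ∣? ℓ ^ 2 + 3 * m ^ 2)

  -- N and K stand for n/2 and (ℓ+m)/2.
  record Condition (m N K : ℕ) : Set where
    field
      N′ K₀ : ℕ
      N≡    : N ≡ m * N′
      K≡    : K ≡ m * suc K₀
      N′∣   : N′ ∣ K₀ * K₀ + K₀ + 1

  gcd-≡ : ∀ {a b g} u v → g ∣ a → g ∣ b → b * u + g ≡ a * v → gcd a b ≡ g
  gcd-≡ {a} {b} u v g∣a g∣b bu+g≡av = ∣-antisym
    (∣m+n∣m⇒∣n (subst (gcd a b ∣_) (sym bu+g≡av) (∣m⇒∣m*n v (gcd[m,n]∣m a b))) (∣m⇒∣m*n u (gcd[m,n]∣n a b)))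
    (gcd-greatest g∣a g∣b)

  ℓ-shape : ∀ {ℓ m K₀} → ℓ + m ≡ 2 * (m * suc K₀) → ℓ ≡ 2 * (m * K₀) + m
  ℓ-shape {ℓ} {m} {K₀} ℓ+m≡ = +-cancelʳ-≡ m ℓ (2 * (m * K₀) + m) (trans ℓ+m≡ (expand m K₀))
    where expand : ∀ m k → 2 * (m * suc k) ≡ 2 * (m * k) + m + m
          expand = solve-∀

  criterion-of-shape : ∀ m N′ K₀ r → K₀ * K₀ + K₀ + 1 ≡ r * N′ →
                       Criterion m (2 * (m * N′)) (2 * (m * K₀) + m)
  criterion-of-shape m N′ K₀ r q≡rN′ = gcd₁ , gcd₂ , divides r square-identity
    where
    2m[K₀²+K₀+1]≡nr : 2 * m * (K₀ * K₀ + K₀ + 1) ≡ 2 * (m * N′) * r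
    2m[K₀²+K₀+1]≡nr = begin
      2 * m * (K₀ * K₀ + K₀ + 1)  ≡⟨ cong (2 * m *_) q≡rN′ ⟩
      2 * m * (r * N′)            ≡⟨ reorder m N′ r ⟩
      2 * (m * N′) * r            ∎
      where reorder : ∀ m N′ r → 2 * m * (r * N′) ≡ 2 * (m * N′) * r
            reorder = solve-∀

    2m∣n : 2 * m ∣ 2 * (m * N′)
    2m∣n = divides N′ (twice m N′)
      where twice : ∀ m k → 2 * (m * k) ≡ k * (2 * m)
            twice = solve-∀

    gcd₁ : gcd (2 * (m * N′)) (2 * (m * K₀) + m + m) ≡ 2 * m
    gcd₁ = gcd-≡ K₀ r 2m∣n (divides (suc K₀) (ℓ+m≡ m K₀)) (trans (combination m K₀) 2m[K₀²+K₀+1]≡nr)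
      where
      ℓ+m≡ : ∀ m k → 2 * (m * k) + m + m ≡ suc k * (2 * m)
      ℓ+m≡ = solve-∀
      combination : ∀ m k → (2 * (m * k) + m + m) * k + 2 * m ≡ 2 * m * (k * k + k + 1)
      combination = solve-∀

    ∣ℓ-m∣≡ : ∣ 2 * (m * K₀) + m - m ∣ ≡ 2 * (m * K₀)
    ∣ℓ-m∣≡ = trans (m≤n⇒∣n-m∣≡n∸m (m≤n+m m _)) (m+n∸n≡m _ m)

    gcd₂ : gcd (2 * (m * N′)) ∣ 2 * (m * K₀) + m - m ∣ ≡ 2 * m
    gcd₂ = trans (cong (gcd (2 * (m * N′))) ∣ℓ-m∣≡)
      (gcd-≡ (suc K₀) r 2m∣n (divides K₀ (ℓ-m≡ m K₀)) (trans (combination m K₀) 2m[K₀²+K₀+1]≡nr))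
      where
      ℓ-m≡ : ∀ m k → 2 * (m * k) ≡ k * (2 * m)
      ℓ-m≡ = solve-∀
      combination : ∀ m k → 2 * (m * k) * suc k + 2 * m ≡ 2 * m * (k * k + k + 1)
      combination = solve-∀

    square-identity : (2 * (m * K₀) + m) ^ 2 + 3 * m ^ 2 ≡ r * (2 * m * (2 * (m * N′)))
    square-identity = begin
      (2 * (m * K₀) + m) ^ 2 + 3 * m ^ 2     ≡⟨ expand m K₀ ⟩
      2 * m * (2 * m * (K₀ * K₀ + K₀ + 1))   ≡⟨ cong (2 * m *_) 2m[K₀²+K₀+1]≡nr ⟩
      2 * m * (2 * (m * N′) * r)             ≡⟨ reorder m N′ r ⟩
      r * (2 * m * (2 * (m * N′)))           ∎
      where
      expand : ∀ m k → (2 * (m * k) + m) * ((2 * (m * k) + m) * 1) + 3 * (m * (m * 1))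
                     ≡ 2 * m * (2 * m * (k * k + k + 1))
      expand = solve-∀
      reorder : ∀ m N′ r → 2 * m * (2 * (m * N′) * r) ≡ r * (2 * m * (2 * (m * N′)))
      reorder = solve-∀

  condition⇒criterion : ∀ {m n ℓ N K} → n ≡ 2 * N → ℓ + m ≡ 2 * K → Condition m N K → Criterion m n ℓ
  condition⇒criterion {m} n≡ ℓ+m≡ record { N′ = N′ ; K₀ = K₀ ; N≡ = refl ; K≡ = refl ; N′∣ = divides r q≡rN′ }
    = subst₂ (Criterion m) (sym n≡) (sym (ℓ-shape ℓ+m≡)) (criterion-of-shape m N′ K₀ r q≡rN′)

  criterion⇒condition : ∀ {m n ℓ N K} → 1 ≤ m → 1 ≤ K → n ≡ 2 * N → ℓ + m ≡ 2 * K →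
                        Criterion m n ℓ → Condition m N K
  criterion⇒condition {m} {n} {ℓ} {N} {K} 1≤m 1≤K n≡ ℓ+m≡ (gcd₁ , _ , 2mn∣) =
    with-K-quotient (quotient 2m∣ℓ+m) (half ℓ+m≡ (m∣n⇒n≡m*quotient 2m∣ℓ+m))
    where
    instance
      m≢0 : NonZero m
      m≢0 = >-nonZero 1≤m

    2m∣n : 2 * m ∣ n
    2m∣n = subst (_∣ n) gcd₁ (gcd[m,n]∣m n (ℓ + m))

    2m∣ℓ+m : 2 * m ∣ ℓ + m
    2m∣ℓ+m = subst (_∣ ℓ + m) gcd₁ (gcd[m,n]∣n n (ℓ + m))

    half : ∀ {a A q} → a ≡ 2 * A → a ≡ 2 * m * q → A ≡ m * q
    half {a} {A} {q} a≡2A a≡2mq = *-cancelˡ-≡ A (m * q) 2 (trans (sym a≡2A) (trans a≡2mq (*-assoc 2 m q)))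

    a = quotient 2m∣n
    N≡ : N ≡ m * a
    N≡ = half n≡ (m∣n⇒n≡m*quotient 2m∣n)

    with-K-quotient : ∀ b → K ≡ m * b → Condition m N K
    with-K-quotient zero    K≡ = contradiction (trans K≡ (*-zeroʳ m)) (≢-nonZero⁻¹ K {{>-nonZero 1≤K}})
    with-K-quotient (suc K₀) K≡ =
      record { N′ = a ; K₀ = K₀ ; N≡ = N≡ ; K≡ = K≡ ; N′∣ = *-cancelˡ-∣ (4 * m * m) 4m²a∣ }
      where
      instance
        4m²≢0 : NonZero (4 * m * m)
        4m²≢0 = m*n≢0 (4 * m) m {{m*n≢0 4 m}}
      4m²a∣ : 4 * m * m * a ∣ 4 * m * m * (K₀ * K₀ + K₀ + 1)
      4m²a∣ = subst₂ _∣_ (2mn≡ m a) (square-identity m K₀) (subst₂ (λ n ℓ → 2 * m * n ∣ ℓ ^ 2 + 3 * m ^ 2)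
                (trans n≡ (cong (2 *_) N≡)) (ℓ-shape {ℓ} {m} {K₀} (trans ℓ+m≡ (cong (2 *_) K≡))) 2mn∣)
        where
        2mn≡ : ∀ m a → 2 * m * (2 * (m * a)) ≡ 4 * m * m * a
        2mn≡ = solve-∀
        square-identity : ∀ m k → (2 * (m * k) + m) * ((2 * (m * k) + m) * 1) + 3 * (m * (m * 1))
                                  ≡ 4 * m * m * (k * k + k + 1)
        square-identity = solve-∀

  cast-quadratic : ∀ k → + (k * k + k + 1) ≡ + k ℤ.* + k ℤ.+ + k ℤ.+ 1ℤ
  cast-quadratic k = begin
    + (k * k + k + 1)              ≡⟨ ℤ.pos-+ (k * k + k) 1 ⟩
    + (k * k + k) ℤ.+ 1ℤ           ≡⟨ cong (ℤ._+ 1ℤ) (ℤ.pos-+ (k * k) k) ⟩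
    + (k * k) ℤ.+ + k ℤ.+ 1ℤ       ≡⟨ cong (λ z → z ℤ.+ + k ℤ.+ 1ℤ) (ℤ.pos-* k k) ⟩
    + k ℤ.* + k ℤ.+ + k ℤ.+ 1ℤ     ∎

  condition⇒shape : ∀ {m N K} → Condition m N K → RotationShape (+ N) (+ K) (+ m)
  condition⇒shape {m} record { N′ = N′ ; K₀ = K₀ ; N≡ = N≡ ; K≡ = K≡ ; N′∣ = divides r quadratic≡ } = record
    { a = + N′ ; k = + K₀ ; r = + r
    ; N≡ = trans (cong +_ N≡) (ℤ.pos-* m N′)
    ; K≡ = trans (cong +_ K≡) (ℤ.pos-* m (suc K₀))
    ; a∣ = trans (sym (cast-quadratic K₀)) (trans (cong +_ quadratic≡) (ℤ.pos-* r N′)) }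

  shape⇒condition : ∀ {m N K} → 1 ≤ m → 1 ≤ K → RotationShape (+ N) (+ K) (+ m) → Condition m N K
  shape⇒condition {m} {N} {K} 1≤m 1≤K record { a = a ; k = k ; r = r ; N≡ = N≡ ; K≡ = K≡ ; a∣ = a∣ } =
    with-∣1+k∣ ∣ 1ℤ ℤ.+ k ∣ refl
    where
    instance
      m≢0 : ℤ.NonZero (+ m)
      m≢0 = >-nonZero 1≤m

    abs-cast : ∀ {n i} → + n ≡ + m ℤ.* i → n ≡ m * ∣ i ∣
    abs-cast {n} {i} n≡mi = trans (cong ∣_∣ n≡mi) (ℤ.abs-* (+ m) i)

    1+k≡∣1+k∣ : 1ℤ ℤ.+ k ≡ + ∣ 1ℤ ℤ.+ k ∣
    1+k≡∣1+k∣ = ℤ.*-cancelˡ-≡ (+ m) (1ℤ ℤ.+ k) (+ ∣ 1ℤ ℤ.+ k ∣)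
      (trans (sym K≡) (trans (cong +_ (abs-cast K≡)) (ℤ.pos-* m ∣ 1ℤ ℤ.+ k ∣)))

    with-∣1+k∣ : ∀ K′ → ∣ 1ℤ ℤ.+ k ∣ ≡ K′ → Condition m N K
    with-∣1+k∣ zero ∣1+k∣≡0 =
      contradiction (trans (abs-cast K≡) (trans (cong (m *_) ∣1+k∣≡0) (*-zeroʳ m)))
                    (≢-nonZero⁻¹ K {{>-nonZero 1≤K}})
    with-∣1+k∣ (suc K₀) ∣1+k∣≡ = record
      { N′ = ∣ a ∣ ; K₀ = K₀
      ; N≡ = abs-cast N≡
      ; K≡ = trans (abs-cast K≡) (cong (m *_) ∣1+k∣≡)
      ; N′∣ = divides ∣ r ∣ (trans (cong ∣_∣ quadratic≡) (ℤ.abs-* r a)) }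
      where
      k≡K₀ : k ≡ + K₀
      k≡K₀ = begin
        k                         ≡⟨ solve (k ∷ []) ⟩
        -1ℤ ℤ.+ (1ℤ ℤ.+ k)        ≡⟨ cong (λ z → -1ℤ ℤ.+ z) (trans 1+k≡∣1+k∣ (cong +_ ∣1+k∣≡)) ⟩
        -1ℤ ℤ.+ + suc K₀          ≡⟨⟩
        + K₀                      ∎
      quadratic≡ : + (K₀ * K₀ + K₀ + 1) ≡ r ℤ.* a
      quadratic≡ = trans (cast-quadratic K₀) (trans (cong (λ z → z ℤ.* z ℤ.+ z ℤ.+ 1ℤ) (sym k≡K₀)) a∣)

open NatArithmetic

module Presented (m n ℓ : ℕ) where

  open import Defs
  open import Data.Integer using (ℤ; +_; 0ℤ; 1ℤ; -1ℤ; -_; _+_; _*_; _-_)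
  import Data.Integer.Properties as ℤ
  open import Data.Integer.Tactic.RingSolver using (solve-∀; solve)
  open import Data.Nat using (_/_; _≤_)
  import Data.Nat as ℕ
  import Data.Nat.Properties as ℕ
  open import Data.Product using (Σ; _×_; _,_)
  import Relation.Binary.Reasoning.Setoid as SetoidReasoning
  open import Relation.Nullary.Decidable using (¬¬-excluded-middle)

  open Presentation m n ℓ public
    using (T; X; Y; _≈_; rel-t²; rel-x; rel-y; rel-tx; rel-ty; rel-xy; Automorphism; HasOrder3; MapsSOnto; InS)
  private module P = Presentation m n ℓ

  G : Group 0ℓ 0ℓ
  G = record
    { Carrier = Word ; _≈_ = _≈_ ; _∙_ = _·_ ; ε = e ; _⁻¹ = inv
    ; isGroup = record
      { isMonoid = record
        { isSemigroup = record
          { isMagma = record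
            { isEquivalence = record { refl = P.≈-refl ; sym = P.≈-sym ; trans = P.≈-trans }
            ; ∙-cong = P.·-cong }
          ; assoc = P.assoc }
        ; identity = P.idˡ , P.idʳ }
      ; inverse = P.invˡ , P.invʳ
      ; ⁻¹-cong = P.inv-cong } }

  open Group G public
    using (setoid; refl; sym; trans; ∙-cong; ∙-congˡ; ∙-congʳ; assoc; identityˡ; identityʳ; ⁻¹-cong)
  open import Algebra.Properties.Group G using (inverseʳ-unique; ⁻¹-anti-homo-∙; ε⁻¹≈ε)
  open IntegerPowers G public
  open SetoidReasoning setoid

  pow≡^ : ∀ w k → pow w k ≡ w ^ + k
  pow≡^ w zero    = ≡.refl
  pow≡^ w (suc k) = ≡.cong (w ·_) (pow≡^ w k)

  N K M : ℤ
  N = + (n / 2)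
  K = + ((ℓ ℕ.+ m) / 2)
  M = + m

  open Lattice N K M public

  ⟦_⟧ : Word → NF
  ⟦ gen t ⟧ = ⟨ true  , 0ℤ , 0ℤ ⟩
  ⟦ gen x ⟧ = ⟨ false , 1ℤ , 0ℤ ⟩
  ⟦ gen y ⟧ = ⟨ false , 0ℤ , 1ℤ ⟩
  ⟦ e ⟧     = 1ᴺ
  ⟦ a · b ⟧ = ⟦ a ⟧ ⊛ ⟦ b ⟧
  ⟦ inv a ⟧ = ⟦ a ⟧ ⁻¹ᴺ

  ⟦^+⟧ : ∀ w {a b} → ⟦ w ⟧ ≡ ⟨ false , a , b ⟩ → ∀ k → ⟦ w ^ + k ⟧ ≡ ⟨ false , + k * a , + k * b ⟩
  ⟦^+⟧ w {a} {b} ⟦w⟧≡ zero = ⟨⟩-cong ≡.refl (≡.sym (ℤ.*-zeroˡ a)) (≡.sym (ℤ.*-zeroˡ b))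
  ⟦^+⟧ w {a} {b} ⟦w⟧≡ (suc k) rewrite ⟦w⟧≡ | ⟦^+⟧ w ⟦w⟧≡ k =
    ⟨⟩-cong ≡.refl (one-more (+ k) a) (one-more (+ k) b)
    where one-more : ∀ k a → a + k * a ≡ (1ℤ + k) * a
          one-more = solve-∀

  ⟦⟧-cong : ∀ {a b} → a ≈ b → ⟦ a ⟧ ~ ⟦ b ⟧
  ⟦⟧-cong Presentation.≈-refl          = ~-refl
  ⟦⟧-cong (Presentation.≈-sym p)       = ~-sym (⟦⟧-cong p)
  ⟦⟧-cong (Presentation.≈-trans p q)   = ~-trans (⟦⟧-cong p) (⟦⟧-cong q)
  ⟦⟧-cong (Presentation.·-cong p q)    = ⊛-cong (⟦⟧-cong p) (⟦⟧-cong q)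
  ⟦⟧-cong (Presentation.inv-cong p)    = ⁻¹ᴺ-cong (⟦⟧-cong p)
  ⟦⟧-cong (Presentation.assoc a b c)   = ~-reflexive (⊛-assoc ⟦ a ⟧ ⟦ b ⟧ ⟦ c ⟧)
  ⟦⟧-cong (Presentation.idˡ a)         = ~-reflexive (⊛-identityˡ ⟦ a ⟧)
  ⟦⟧-cong (Presentation.idʳ a)         = ~-reflexive (⊛-identityʳ ⟦ a ⟧)
  ⟦⟧-cong (Presentation.invˡ a)        = ~-reflexive (⊛-inverseˡ ⟦ a ⟧)
  ⟦⟧-cong (Presentation.invʳ a)        = ~-reflexive (⊛-inverseʳ ⟦ a ⟧)
  ⟦⟧-cong Presentation.rel-t²          = ~-refl
  ⟦⟧-cong Presentation.rel-x rewrite pow≡^ X (n / 2) | ⟦^+⟧ X ≡.refl (n / 2) =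
    mk~ ≡.refl (ℒ-resp ℒ-N (x-coordinate N) (y-coordinate N))
    where
    x-coordinate : ∀ N → N ≡ N * 1ℤ - 0ℤ
    x-coordinate = solve-∀
    y-coordinate : ∀ N → 0ℤ ≡ N * 0ℤ - 0ℤ
    y-coordinate = solve-∀
  ⟦⟧-cong Presentation.rel-y
    rewrite pow≡^ Y m | pow≡^ X ((ℓ ℕ.+ m) / 2) | ⟦^+⟧ Y ≡.refl m | ⟦^+⟧ X ≡.refl ((ℓ ℕ.+ m) / 2) =
    mk~ ≡.refl (ℒ-resp (ℒ-neg ℒ-K) (x-coordinate M K) (y-coordinate M K))
    where
    x-coordinate : ∀ M K → - K ≡ M * 0ℤ - K * 1ℤ
    x-coordinate = solve-∀
    y-coordinate : ∀ M K → - - M ≡ M * 1ℤ - K * 0ℤ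
    y-coordinate = solve-∀
  ⟦⟧-cong Presentation.rel-tx          = ~-refl
  ⟦⟧-cong Presentation.rel-ty          = ~-refl
  ⟦⟧-cong Presentation.rel-xy          = ~-refl

  tᵇ : Bool → Word
  tᵇ true  = T
  tᵇ false = e

  xy : ℤ → ℤ → Word
  xy i j = X ^ i · Y ^ j

  word : NF → Word
  word ⟨ s , i , j ⟩ = tᵇ s · xy i j

  xy-≡ : ∀ {i i′ j j′} → i ≡ i′ → j ≡ j′ → xy i j ≈ xy i′ j′
  xy-≡ ≡.refl ≡.refl = refl

  xy-· : ∀ i j i′ j′ → xy i j · xy i′ j′ ≈ xy (i + i′) (j + j′)
  xy-· i j i′ j′ = begin
    X ^ i · Y ^ j · (X ^ i′ · Y ^ j′)       ≈⟨ assoc _ _ _ ⟩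
    X ^ i · (Y ^ j · (X ^ i′ · Y ^ j′))     ≈⟨ ∙-congˡ (assoc _ _ _) ⟨
    X ^ i · (Y ^ j · X ^ i′ · Y ^ j′)       ≈⟨ ∙-congˡ (∙-congʳ (commute-^ (sym rel-xy) j i′)) ⟩
    X ^ i · (X ^ i′ · Y ^ j · Y ^ j′)       ≈⟨ ∙-congˡ (assoc _ _ _) ⟩
    X ^ i · (X ^ i′ · (Y ^ j · Y ^ j′))     ≈⟨ assoc _ _ _ ⟨
    X ^ i · X ^ i′ · (Y ^ j · Y ^ j′)       ≈⟨ ∙-cong (^-homo-+ X i i′) (^-homo-+ Y j j′) ⟨
    xy (i + i′) (j + j′)                    ∎

  xy-⁻¹ : ∀ i j → inv (xy i j) ≈ xy (- i) (- j)
  xy-⁻¹ i j = begin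
    inv (X ^ i · Y ^ j)              ≈⟨ ⁻¹-anti-homo-∙ (X ^ i) (Y ^ j) ⟩
    inv (Y ^ j) · inv (X ^ i)        ≈⟨ ∙-cong (^-neg Y j) (^-neg X i) ⟨
    Y ^ (- j) · X ^ (- i)            ≈⟨ commute-^ (sym rel-xy) (- j) (- i) ⟩
    xy (- i) (- j)                   ∎

  T⁻¹≈T : inv T ≈ T
  T⁻¹≈T = sym (inverseʳ-unique T T rel-t²)

  conj-T-^ : ∀ {w} → T · w · T ≈ inv w → ∀ i → conj T (w ^ i) ≈ w ^ (- i)
  conj-T-^ {w} TwT≈w⁻¹ i = begin
    conj T (w ^ i)        ≈⟨ Conj.h-^ T w i ⟩
    conj T w ^ i          ≈⟨ ^-congˡ (trans (∙-congˡ T⁻¹≈T) TwT≈w⁻¹) i ⟩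
    inv w ^ i             ≈⟨ ⁻¹-^ w i ⟩
    inv (w ^ i)           ≈⟨ ^-neg w i ⟨
    w ^ (- i)             ∎

  xy-T : ∀ i j → xy i j · T ≈ T · xy (- i) (- j)
  xy-T i j = sym (conj≈⇒∙-swap (begin
    conj T (X ^ (- i) · Y ^ (- j))                 ≈⟨ conj-hom T _ _ ⟩
    conj T (X ^ (- i)) · conj T (Y ^ (- j))        ≈⟨ ∙-cong (conj-T-^ rel-tx (- i)) (conj-T-^ rel-ty (- j)) ⟩
    xy (- - i) (- - j)                             ≈⟨ xy-≡ (ℤ.neg-involutive i) (ℤ.neg-involutive j) ⟩
    xy i j                                         ∎))

  word-⊛ : ∀ u v → word u · word v ≈ word (u ⊛ v)
  word-⊛ ⟨ s , i , j ⟩ ⟨ false , i′ , j′ ⟩ = begin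
    tᵇ s · xy i j · (e · xy i′ j′)       ≈⟨ ∙-congˡ (identityˡ _) ⟩
    tᵇ s · xy i j · xy i′ j′             ≈⟨ assoc _ _ _ ⟩
    tᵇ s · (xy i j · xy i′ j′)           ≈⟨ ∙-cong (tᵇ-xor-false s) (xy-· i j i′ j′) ⟩
    tᵇ (s xor false) · xy (i + i′) (j + j′) ∎
    where
    tᵇ-xor-false : ∀ s → tᵇ s ≈ tᵇ (s xor false)
    tᵇ-xor-false false = refl
    tᵇ-xor-false true  = refl
  word-⊛ ⟨ s , i , j ⟩ ⟨ true , i′ , j′ ⟩ = begin
    tᵇ s · xy i j · (T · xy i′ j′)                 ≈⟨ assoc _ _ _ ⟩
    tᵇ s · (xy i j · (T · xy i′ j′))               ≈⟨ ∙-congˡ (assoc _ _ _) ⟨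
    tᵇ s · (xy i j · T · xy i′ j′)                 ≈⟨ ∙-congˡ (∙-congʳ (xy-T i j)) ⟩
    tᵇ s · (T · xy (- i) (- j) · xy i′ j′)         ≈⟨ ∙-congˡ (assoc _ _ _) ⟩
    tᵇ s · (T · (xy (- i) (- j) · xy i′ j′))       ≈⟨ assoc _ _ _ ⟨
    tᵇ s · T · (xy (- i) (- j) · xy i′ j′)         ≈⟨ ∙-cong (tᵇ-xor-true s) (xy-· (- i) (- j) i′ j′) ⟩
    tᵇ (s xor true) · xy (- i + i′) (- j + j′)     ∎
    where
    tᵇ-xor-true : ∀ s → tᵇ s · T ≈ tᵇ (s xor true)
    tᵇ-xor-true false = identityˡ T
    tᵇ-xor-true true  = rel-t²

  word-⁻¹ᴺ : ∀ u → inv (word u) ≈ word (u ⁻¹ᴺ)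
  word-⁻¹ᴺ ⟨ false , i , j ⟩ = begin
    inv (e · xy i j)              ≈⟨ ⁻¹-anti-homo-∙ e (xy i j) ⟩
    inv (xy i j) · inv e          ≈⟨ ∙-cong (xy-⁻¹ i j) ε⁻¹≈ε ⟩
    xy (- i) (- j) · e            ≈⟨ identityʳ _ ⟩
    xy (- i) (- j)                ≈⟨ identityˡ _ ⟨
    e · xy (- i) (- j)            ∎
  word-⁻¹ᴺ ⟨ true , i , j ⟩ = begin
    inv (T · xy i j)              ≈⟨ ⁻¹-anti-homo-∙ T (xy i j) ⟩
    inv (xy i j) · inv T          ≈⟨ ∙-cong (xy-⁻¹ i j) T⁻¹≈T ⟩
    xy (- i) (- j) · T            ≈⟨ xy-T (- i) (- j) ⟩
    T · xy (- - i) (- - j)        ≈⟨ ∙-congˡ (xy-≡ (ℤ.neg-involutive i) (ℤ.neg-involutive j)) ⟩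
    T · xy i j                    ∎

  word-⟦⟧ : ∀ a → a ≈ word ⟦ a ⟧
  word-⟦⟧ (gen t) = sym (trans (∙-congˡ (identityˡ e)) (identityʳ T))
  word-⟦⟧ (gen x) = sym (trans (identityˡ _) (trans (identityʳ _) (identityʳ X)))
  word-⟦⟧ (gen y) = sym (trans (identityˡ _) (trans (identityˡ _) (identityʳ Y)))
  word-⟦⟧ e       = sym (trans (identityˡ _) (identityʳ e))
  word-⟦⟧ (a · b) = trans (∙-cong (word-⟦⟧ a) (word-⟦⟧ b)) (word-⊛ ⟦ a ⟧ ⟦ b ⟧)
  word-⟦⟧ (inv a) = trans (⁻¹-cong (word-⟦⟧ a)) (word-⁻¹ᴺ ⟦ a ⟧)

  X^N≈e : X ^ N ≈ e
  X^N≈e = ≡.subst (_≈ e) (pow≡^ X (n / 2)) rel-x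

  Y^M≈X^K : Y ^ M ≈ X ^ K
  Y^M≈X^K = ≡.subst₂ _≈_ (pow≡^ Y m) (pow≡^ X ((ℓ ℕ.+ m) / 2)) rel-y

  xy-ℒ : ∀ {a b} → ℒ a b → xy a b ≈ e
  xy-ℒ (p , q , ≡.refl , ≡.refl) = begin
    xy (p * N + q * K) (- (q * M))                  ≈⟨ xy-≡ {p * N + q * K} ≡.refl (ℤ.+-identityˡ (- (q * M))) ⟨
    xy (p * N + q * K) (0ℤ + - (q * M))             ≈⟨ xy-· (p * N) 0ℤ (q * K) (- (q * M)) ⟨
    xy (p * N) 0ℤ · xy (q * K) (- (q * M))          ≈⟨ ∙-cong (identityʳ _) x^qK·y^-qM≈e ⟩
    X ^ (p * N) · e                                  ≈⟨ identityʳ _ ⟩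
    X ^ (p * N)                                      ≡⟨ ≡.cong (X ^_) (ℤ.*-comm p N) ⟩
    X ^ (N * p)                                      ≈⟨ ^-* X N p ⟩
    (X ^ N) ^ p                                      ≈⟨ ^-congˡ X^N≈e p ⟩
    e ^ p                                            ≈⟨ ε^ p ⟩
    e                                                ∎
    where
    x^qK·y^-qM≈e : xy (q * K) (- (q * M)) ≈ e
    x^qK·y^-qM≈e = begin
      X ^ (q * K) · Y ^ (- (q * M))           ≡⟨ ≡.cong₂ (λ a b → X ^ a · Y ^ b) (ℤ.*-comm q K)
                                                   (≡.trans (ℤ.neg-distribˡ-* q M) (ℤ.*-comm (- q) M)) ⟩
      X ^ (K * q) · Y ^ (M * - q)             ≈⟨ ∙-cong (^-* X K q) (^-* Y M (- q)) ⟩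
      (X ^ K) ^ q · (Y ^ M) ^ (- q)           ≈⟨ ∙-congˡ (^-congˡ Y^M≈X^K (- q)) ⟩
      (X ^ K) ^ q · (X ^ K) ^ (- q)           ≈⟨ ^-homo-+ (X ^ K) q (- q) ⟨
      (X ^ K) ^ (q + - q)                     ≡⟨ ≡.cong ((X ^ K) ^_) (ℤ.+-inverseʳ q) ⟩
      e                                       ∎

  word-cong : ∀ {u v} → u ~ v → word u ≈ word v
  word-cong {⟨ s , i , j ⟩} {⟨ _ , i′ , j′ ⟩} (mk~ ≡.refl l) = ∙-congˡ (begin
    xy i j                                        ≈⟨ xy-≡ (split i i′) (split j j′) ⟩
    xy (i - i′ + i′) (j - j′ + j′)                ≈⟨ xy-· (i - i′) (j - j′) i′ j′ ⟨
    xy (i - i′) (j - j′) · xy i′ j′               ≈⟨ ∙-congʳ (xy-ℒ l) ⟩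
    e · xy i′ j′                                  ≈⟨ identityˡ _ ⟩
    xy i′ j′                                      ∎)
    where split : ∀ a b → a ≡ a - b + b
          split = solve-∀

  ⟦⟧-injective : ∀ {a b} → ⟦ a ⟧ ~ ⟦ b ⟧ → a ≈ b
  ⟦⟧-injective {a} {b} ⟦a⟧~⟦b⟧ = trans (word-⟦⟧ a) (trans (word-cong ⟦a⟧~⟦b⟧) (sym (word-⟦⟧ b)))

  -- The rotation t ↦ t x ↦ t y ↦ t

  [_] : Bool → ℤ
  [ true  ] = 1ℤ
  [ false ] = 0ℤ

  rotate : Word → Word
  rotate (gen t) = T · X
  rotate (gen x) = inv X · Y
  rotate (gen y) = inv X
  rotate e       = e
  rotate (a · b) = rotate a · rotate b
  rotate (inv a) = inv (rotate a)

  -- rotate (t^s x^i y^j) = (t x)^s (x⁻¹ y)^i x^-j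
  rotateᴺ : NF → NF
  rotateᴺ ⟨ s , i , j ⟩ = ⟨ s , [ s ] - i - j , i ⟩

  rotateᴺ-⊛ : ∀ u v → rotateᴺ (u ⊛ v) ≡ rotateᴺ u ⊛ rotateᴺ v
  rotateᴺ-⊛ ⟨ s , i , j ⟩ ⟨ false , i′ , j′ ⟩ = ⟨⟩-cong ≡.refl (x-part s) ≡.refl
    where
    x-part : ∀ s → [ s xor false ] - (i + i′) - (j + j′) ≡ [ s ] - i - j + ([ false ] - i′ - j′)
    x-part false = solve (i ∷ j ∷ i′ ∷ j′ ∷ [])
    x-part true  = solve (i ∷ j ∷ i′ ∷ j′ ∷ [])
  rotateᴺ-⊛ ⟨ s , i , j ⟩ ⟨ true , i′ , j′ ⟩ = ⟨⟩-cong ≡.refl (x-part s) ≡.refl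
    where
    x-part : ∀ s → [ s xor true ] - (- i + i′) - (- j + j′) ≡ - ([ s ] - i - j) + ([ true ] - i′ - j′)
    x-part false = solve (i ∷ j ∷ i′ ∷ j′ ∷ [])
    x-part true  = solve (i ∷ j ∷ i′ ∷ j′ ∷ [])

  rotateᴺ-⁻¹ᴺ : ∀ u → rotateᴺ (u ⁻¹ᴺ) ≡ rotateᴺ u ⁻¹ᴺ
  rotateᴺ-⁻¹ᴺ ⟨ false , i , j ⟩ = ⟨⟩-cong ≡.refl (negated i j) ≡.refl
    where negated : ∀ i j → 0ℤ - - i - - j ≡ - (0ℤ - i - j)
          negated = solve-∀
  rotateᴺ-⁻¹ᴺ ⟨ true  , i , j ⟩ = ≡.refl

  rotateᴺ³ : ∀ u → rotateᴺ (rotateᴺ (rotateᴺ u)) ≡ u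
  rotateᴺ³ ⟨ s , i , j ⟩ = ⟨⟩-cong ≡.refl (cycle-x [ s ] i j) (cycle-y [ s ] i j)
    where
    cycle-x : ∀ c i j → c - (c - (c - i - j) - i) - (c - i - j) ≡ i
    cycle-x = solve-∀
    cycle-y : ∀ c i j → c - (c - i - j) - i ≡ j
    cycle-y = solve-∀

  ⟦rotate⟧ : ∀ a → ⟦ rotate a ⟧ ≡ rotateᴺ ⟦ a ⟧
  ⟦rotate⟧ (gen t) = ≡.refl
  ⟦rotate⟧ (gen x) = ≡.refl
  ⟦rotate⟧ (gen y) = ≡.refl
  ⟦rotate⟧ e       = ≡.refl
  ⟦rotate⟧ (a · b) = ≡.trans (≡.cong₂ _⊛_ (⟦rotate⟧ a) (⟦rotate⟧ b)) (≡.sym (rotateᴺ-⊛ ⟦ a ⟧ ⟦ b ⟧))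
  ⟦rotate⟧ (inv a) = ≡.trans (≡.cong _⁻¹ᴺ (⟦rotate⟧ a)) (≡.sym (rotateᴺ-⁻¹ᴺ ⟦ a ⟧))

  rotate³ : ∀ a → rotate (rotate (rotate a)) ≈ a
  rotate³ a = ⟦⟧-injective (~-reflexive (≡.trans (⟦rotate⟧ (rotate (rotate a)))
    (≡.trans (≡.cong rotateᴺ (⟦rotate⟧ (rotate a)))
    (≡.trans (≡.cong (rotateᴺ ∘ rotateᴺ) (⟦rotate⟧ a)) (rotateᴺ³ ⟦ a ⟧)))))

  module Rotation (ℒ-image-N : ℒ (- N) N) (ℒ-image-K : ℒ (M - K) K) where

    rotateᴺ-cong : ∀ {u v} → u ~ v → rotateᴺ u ~ rotateᴺ v
    rotateᴺ-cong {⟨ s , i , j ⟩} {⟨ _ , i′ , j′ ⟩} (mk~ ≡.refl l) =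
      mk~ ≡.refl (ℒ-resp (ℒ-rotate ℒ-image-N ℒ-image-K l) (difference [ s ] i j i′ j′) ≡.refl)
      where difference : ∀ c i j i′ j′ → - (i - i′) - (j - j′) ≡ (c - i - j) - (c - i′ - j′)
            difference = solve-∀

    rotate-cong : ∀ {a b} → a ≈ b → rotate a ≈ rotate b
    rotate-cong {a} {b} a≈b =
      ⟦⟧-injective (≡.subst₂ _~_ (≡.sym (⟦rotate⟧ a)) (≡.sym (⟦rotate⟧ b)) (rotateᴺ-cong (⟦⟧-cong a≈b)))

    automorphism : Automorphism
    automorphism = record
      { φ      = rotate
      ; φ-cong = rotate-cong
      ; φ-hom  = λ _ _ → refl
      ; φ-inj  = λ {a} {b} ra≈rb → trans (sym (rotate³ a)) (trans (rotate-cong (rotate-cong ra≈rb)) (rotate³ b))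
      ; φ-surj = λ g → rotate (rotate g) , rotate³ g
      }

    module _ (T·X≉T : ¬ T · X ≈ T) where

      has-order-3 : HasOrder3 automorphism
      has-order-3 = rotate³ , λ rotate≈id → T·X≉T (rotate≈id (gen t))

      maps-S-onto : MapsSOnto automorphism
      maps-S-onto = (inj₂ (inj₁ refl) , inj₂ (inj₂ rotate-TX) , inj₁ rotate-TY) , preimage
        where
        rotate-TX : rotate (T · X) ≈ T · Y
        rotate-TX = ⟦⟧-injective ~-refl
        rotate-TY : rotate (T · Y) ≈ T
        rotate-TY = ⟦⟧-injective ~-refl
        preimage : ∀ w → InS w → Σ Word (λ s → InS s × rotate s ≈ w)
        preimage w (inj₁ w≈T)        = T · Y , inj₂ (inj₂ refl) , trans rotate-TY (sym w≈T)
        preimage w (inj₂ (inj₁ w≈TX)) = T , inj₁ refl , sym w≈TX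
        preimage w (inj₂ (inj₂ w≈TY)) = T · X , inj₂ (inj₁ refl) , trans rotate-TX (sym w≈TY)

  -- Automorphisms permuting S

  T·X≉T : 1 ≤ m → 2 ≤ n / 2 → ¬ T · X ≈ T
  T·X≉T 1≤m 2≤N T·X≈T with mk~ _ ℒ[1,0] ← ⟦⟧-cong T·X≈T =
    ℕ.<⇒≢ 2≤N (≡.sym (ℒ[1,0]⇒∣N∣≡1 M≢0 ℒ[1,0]))
    where
    M≢0 : M ≢ 0ℤ
    M≢0 M≡0 = ℕ.<⇒≢ 1≤m (≡.sym (ℤ.+-injective M≡0))

  X≈T·T·X : X ≈ T · (T · X)
  X≈T·T·X = ⟦⟧-injective ~-refl

  Y≈T·T·Y : Y ≈ T · (T · Y)
  Y≈T·T·Y = ⟦⟧-injective ~-refl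

  module _ (h : Word → Word) (h-cong : ∀ {a b} → a ≈ b → h a ≈ h b)
           (h-hom : ∀ a b → h (a · b) ≈ h a · h b) where
    open Endomorphism h h-cong h-hom

    fixing-S⇒identity : h T ≈ T → h (T · X) ≈ T · X → h (T · Y) ≈ T · Y → ∀ w → h w ≈ w
    fixing-S⇒identity hT hTX hTY = fixes
      where
      fixes : ∀ w → h w ≈ w
      fixes (gen t) = hT
      fixes (gen x) = trans (h-cong X≈T·T·X) (trans (h-hom T (T · X)) (trans (∙-cong hT hTX) (sym X≈T·T·X)))
      fixes (gen y) = trans (h-cong Y≈T·T·Y) (trans (h-hom T (T · Y)) (trans (∙-cong hT hTY) (sym Y≈T·T·Y)))
      fixes e       = h-ε
      fixes (a · b) = trans (h-hom a b) (∙-cong (fixes a) (fixes b))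
      fixes (inv a) = trans (h-⁻¹ a) (⁻¹-cong (fixes a))

    cycling-S⇒ℒ-images : h T ≈ T · X → h (T · X) ≈ T · Y → h (T · Y) ≈ T → ℒ (- N) N × ℒ (M - K) K
    cycling-S⇒ℒ-images hT hTX hTY = ℒ-image-N , ℒ-image-K
      where
      hX : h X ≈ T · X · (T · Y)
      hX = trans (h-cong X≈T·T·X) (trans (h-hom T (T · X)) (∙-cong hT hTX))
      hY : h Y ≈ T · X · T
      hY = trans (h-cong Y≈T·T·Y) (trans (h-hom T (T · Y)) (∙-cong hT hTY))

      image-of-X^N : (T · X · (T · Y)) ^ N ≈ e
      image-of-X^N = begin
        (T · X · (T · Y)) ^ N           ≈⟨ ^-congˡ hX N ⟨
        h X ^ N                         ≈⟨ h-^ X N ⟨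
        h (X ^ N)                       ≈⟨ h-cong X^N≈e ⟩
        h e                             ≈⟨ h-ε ⟩
        e                               ∎

      image-of-Y^M≈X^K : (T · X · T) ^ M ≈ (T · X · (T · Y)) ^ K
      image-of-Y^M≈X^K = begin
        (T · X · T) ^ M             ≈⟨ ^-congˡ hY M ⟨
        h Y ^ M                     ≈⟨ h-^ Y M ⟨
        h (Y ^ M)                   ≈⟨ h-cong Y^M≈X^K ⟩
        h (X ^ K)                   ≈⟨ h-^ X K ⟩
        h X ^ K                     ≈⟨ ^-congˡ hX K ⟩
        (T · X · (T · Y)) ^ K       ∎

      ℒ-image-N : ℒ (- N) N
      ℒ-image-N with mk~ _ l ← ⟦⟧-cong image-of-X^N
                   rewrite ⟦^+⟧ (T · X · (T · Y)) ≡.refl (n / 2) =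
        ℒ-resp l (x-coordinate N) (y-coordinate N)
        where
        x-coordinate : ∀ N → N * -1ℤ - 0ℤ ≡ - N
        x-coordinate = solve-∀
        y-coordinate : ∀ N → N * 1ℤ - 0ℤ ≡ N
        y-coordinate = solve-∀

      ℒ-image-K : ℒ (M - K) K
      ℒ-image-K with mk~ _ l ← ⟦⟧-cong image-of-Y^M≈X^K
                   rewrite ⟦^+⟧ (T · X · T) ≡.refl m | ⟦^+⟧ (T · X · (T · Y)) ≡.refl ((ℓ ℕ.+ m) / 2) =
        ℒ-resp (ℒ-neg l) (x-coordinate M K) (y-coordinate M K)
        where
        x-coordinate : ∀ M K → - (M * -1ℤ - K * -1ℤ) ≡ M - K
        x-coordinate = solve-∀
        y-coordinate : ∀ M K → - (M * 0ℤ - K * 1ℤ) ≡ K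
        y-coordinate = solve-∀

  order-three⇒¬¬ℒ-images : ¬ T · X ≈ T → Σ Automorphism (λ A → HasOrder3 A × MapsSOnto A) →
                            ¬ ¬ (ℒ (- N) N × ℒ (M - K) K)
  order-three⇒¬¬ℒ-images T·X≉T (A , (φ³≈id , φ≉id) , (φT∈ , φTX∈ , φTY∈) , _) ¬images =
    ¬¬-excluded-middle λ T·Y≈T? → ¬¬-excluded-middle λ T·Y≈T·X? → by-cases T·Y≈T? T·Y≈T·X?
    where
    open Automorphism A
    open OrderThreeMaps setoid φ φ-cong φ-inj φ³≈id

    φ² : Word → Word
    φ² = φ ∘ φ

    not-identity : φ T ≈ T → φ (T · X) ≈ T · X → φ (T · Y) ≈ T · Y → ⊥
    not-identity φT≈T φTX≈TX φTY≈TY = φ≉id (fixing-S⇒identity φ φ-cong φ-hom φT≈T φTX≈TX φTY≈TY)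

    T≉T·X : ¬ T ≈ T · X
    T≉T·X T≈TX = T·X≉T (sym T≈TX)

    degenerate : T · Y ≈ T ⊎ T · Y ≈ T · X → ⊥
    degenerate T·Y≈T∨T·X with φT≈T , φTX≈TX , φTY≈TY ← fixes-degenerate-triple T≉T·X T·Y≈T∨T·X φT∈ φTX∈ =
      not-identity φT≈T φTX≈TX φTY≈TY

    by-cases : Dec (T · Y ≈ T) → Dec (T · Y ≈ T · X) → ⊥
    by-cases (yes T·Y≈T) _ = degenerate (inj₁ T·Y≈T)
    by-cases _ (yes T·Y≈T·X) = degenerate (inj₂ T·Y≈T·X)
    by-cases (no T·Y≉T) (no T·Y≉T·X)
      with order-three-on-triple T≉T·X (T·Y≉T·X ∘ sym) (T·Y≉T ∘ sym) φT∈ φTX∈ φTY∈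
    ... | inj₁ (φT≈T , φTX≈TX , φTY≈TY) = not-identity φT≈T φTX≈TX φTY≈TY
    ... | inj₂ (inj₁ (φT≈TX , φTX≈TY , φTY≈T)) =
      ¬images (cycling-S⇒ℒ-images φ φ-cong φ-hom φT≈TX φTX≈TY φTY≈T)
    ... | inj₂ (inj₂ (φT≈TY , φTY≈TX , φTX≈T)) =
      ¬images (cycling-S⇒ℒ-images φ² (φ-cong ∘ φ-cong) (λ a b → trans (φ-cong (φ-hom a b)) (φ-hom (φ a) (φ b)))
                 (trans (φ-cong φT≈TY) φTY≈TX) (trans (φ-cong φTX≈T) φT≈TY) (trans (φ-cong φTY≈TX) φTX≈T))

open import Data.Nat using (_+_; _*_; _^_; _≤_; _<_; ∣_-_∣; _/_)
open import Data.Nat.Divisibility using (_∣_)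
open import Data.Nat.GCD using (gcd)
open import Data.Product using (Σ; _×_; _,_; proj₁; proj₂)
open import Defs using (module Presentation; _·_)
open import Function.Bundles using (_⇔_; mk⇔)

module Characterisation (m n ℓ : ℕ) (1≤m : 1 ≤ m) (4≤n : 4 ≤ n) (2∣n : 2 ∣ n) (2∣ℓ+m : 2 ∣ ℓ + m) where

  open Presented m n ℓ
  open import Data.Integer using (0ℤ; -_; _-_)
  import Data.Integer.Properties as ℤ
  import Data.Nat.Properties as ℕ
  open import Data.Nat.DivMod using (m*[n/m]≡n)
  open import Relation.Nullary.Decidable using (decidable-stable)
  open import Relation.Nullary.Negation using (¬¬-map)

  n≡ : n ≡ 2 * (n / 2)
  n≡ = ≡.sym (m*[n/m]≡n 2∣n)

  ℓ+m≡ : ℓ + m ≡ 2 * ((ℓ + m) / 2)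
  ℓ+m≡ = ≡.sym (m*[n/m]≡n 2∣ℓ+m)

  2≤N : 2 ≤ n / 2
  2≤N = ℕ.*-cancelˡ-≤ 2 (≡.subst (4 ≤_) n≡ 4≤n)

  1≤K : 1 ≤ (ℓ + m) / 2
  1≤K = ℕ.n≢0⇒n>0 λ K≡0 → ℕ.<⇒≱ 1≤m (≡.subst (m ≤_) (≡.trans ℓ+m≡ (≡.cong (2 *_) K≡0)) (ℕ.m≤n+m m ℓ))

  TX≉T : ¬ T · X ≈ T
  TX≉T = T·X≉T 1≤m 2≤N

  ℒ-images⇒criterion : ℒ (- N) N × ℒ (M - K) K → Criterion m n ℓ
  ℒ-images⇒criterion (ℒ-image-N , ℒ-image-K) =
    condition⇒criterion n≡ ℓ+m≡ (shape⇒condition 1≤m 1≤K (ℒ-rotated-generators⇒shape N≢0 M≢0 ℒ-image-N ℒ-image-K))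
    where
    N≢0 : N ≢ 0ℤ
    N≢0 N≡0 = ℕ.<⇒≢ (ℕ.≤-trans (ℕ.n≤1+n 1) 2≤N) (≡.sym (ℤ.+-injective N≡0))
    M≢0 : M ≢ 0ℤ
    M≢0 M≡0 = ℕ.<⇒≢ 1≤m (≡.sym (ℤ.+-injective M≡0))

  criterion⇒ℒ-images : Criterion m n ℓ → ℒ (- N) N × ℒ (M - K) K
  criterion⇒ℒ-images c = shape⇒ℒ-rotated-generators (condition⇒shape (criterion⇒condition 1≤m 1≤K n≡ ℓ+m≡ c))

  necessary : Σ Automorphism (λ A → HasOrder3 A × MapsSOnto A) → Criterion m n ℓ
  necessary A = decidable-stable (criterion? m n ℓ)
    (¬¬-map ℒ-images⇒criterion (order-three⇒¬¬ℒ-images TX≉T A))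

  sufficient : Criterion m n ℓ → Σ Automorphism (λ A → HasOrder3 A × MapsSOnto A)
  sufficient c = automorphism , has-order-3 TX≉T , maps-S-onto TX≉T
    where open Rotation (proj₁ (criterion⇒ℒ-images c)) (proj₂ (criterion⇒ℒ-images c))

lemma4p4 : (m n ℓ : ℕ) → 1 ≤ m → 4 ≤ n → 2 ∣ n → ℓ < n → 2 ∣ (ℓ + m)
    → (Σ (Presentation.Automorphism m n ℓ) (λ A → Presentation.HasOrder3 m n ℓ A × Presentation.MapsSOnto m n ℓ A))
    ⇔ ((gcd n (ℓ + m) ≡ 2 * m) × (gcd n ∣ ℓ - m ∣ ≡ 2 * m) × (2 * m * n ∣ ℓ ^ 2 + 3 * m ^ 2))
lemma4p4 m n ℓ 1≤m 4≤n 2∣n _ 2∣ℓ+m = mk⇔ necessary sufficient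
  where open Characterisation m n ℓ 1≤m 4≤n 2∣n 2∣ℓ+m
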